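{- Let $(B_n)_{n\ge0}$ and $(C_n)_{n\ge0}$ be the balancing and Lucas-balancing numbers. For every integer $n\ge 0$, $$\sum_{k=0}^{2n}\binom{2n}{k}B_k=8^nB_n,\quad \sum_{k=0}^{2n}\binom{2n}{k}C_k=8^nC_n,\quad \sum_{k=0}^{2n}\binom{2n}{k}(-1)^kB_k=4^nB_n,\quad \sum_{k=0}^{2n}\binom{2n}{k}(-1)^kC_k=4^nC_n.$$
   Context: The balancing numbers are defined by $B_0=0$, $B_1=1$, $B_n=6B_{n-1}-B_{n-2}$ for $n\ge 2$. The Lucas-balancing numbers are defined by $C_0=1$, $C_1=3$, $C_n=6C_{n-1}-C_{n-2}$ for $n\ge 2$. -}

module Defs where

open import Data.Nat using (ℕ; zero; suc)
open import Data.Nat.Combinatorics using (_C_)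
open import Data.Integer using (ℤ; +_; _+_; _-_; _*_; -_)

B : ℕ → ℤ
B zero = + 0
B (suc zero) = + 1
B (suc (suc n)) = + 6 * B (suc n) - B n

Cb : ℕ → ℤ
Cb zero = + 1
Cb (suc zero) = + 3
Cb (suc (suc n)) = + 6 * Cb (suc n) - Cb n

sgn : ℕ → ℤ
sgn zero = + 1
sgn (suc k) = - sgn k

sumTo : ℕ → (ℕ → ℤ) → ℤ
sumTo zero f = f zero
sumTo (suc m) f = sumTo m f + f (suc m)

-- If f (k + 2) = a f (k + 1) − f k, then Pascal's rule applied twice gives
--   Σ_k C(m+2,k) f k = Σ_k C(m,k) (f k + 2 f (k+1) + f (k+2)) = (a + 2) Σ_k C(m,k) f (k+1),
-- so each step from 2n to 2n + 2 multiplies by a + 2 and shifts f by one; hence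
-- Σ_k C(2n,k) f k = (a + 2)ⁿ f n.  Balancing and Lucas-balancing numbers have a = 6,
-- and multiplying by (−1)ᵏ turns the recurrence for a into the one for −a.
module Submission where

open import Defs
open import Data.Nat using (ℕ; zero; suc; _^_)
import Data.Nat as ℕ
open import Data.Nat.Properties using (n<1+n; *-suc)
open import Data.Nat.Combinatorics using (_C_; nCk+nC[k+1]≡[n+1]C[k+1]; k>n⇒nCk≡0)
open import Data.Integer using (ℤ; +_; _+_; _-_; _*_; -_)
import Data.Integer as ℤ
open import Data.Integer.Properties
  using (pos-+; pos-*; *-assoc; *-identityˡ; *-zeroˡ; +-identityʳ; *-distribʳ-+; neg-involutive)
open import Data.Integer.Tactic.RingSolver using (solve-∀)
open import Data.Product using (_×_; _,_)
open import Relation.Binary.PropositionalEquality using (_≡_; refl; sym; trans; cong; cong₂; module ≡-Reasoning)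
open ≡-Reasoning

sumTo-cong : ∀ m {f g : ℕ → ℤ} → (∀ k → f k ≡ g k) → sumTo m f ≡ sumTo m g
sumTo-cong zero    f≡g = f≡g 0
sumTo-cong (suc m) f≡g = cong₂ _+_ (sumTo-cong m f≡g) (f≡g (suc m))

sumTo-unfoldˡ : ∀ m (f : ℕ → ℤ) → sumTo (suc m) f ≡ f 0 + sumTo m (λ k → f (suc k))
sumTo-unfoldˡ zero    f = refl
sumTo-unfoldˡ (suc m) f = begin
  sumTo (suc m) f + f (suc (suc m))                          ≡⟨ cong (_+ f (suc (suc m))) (sumTo-unfoldˡ m f) ⟩
  (f 0 + sumTo m (λ k → f (suc k))) + f (suc (suc m))        ≡⟨ assoc (f 0) _ _ ⟩
  f 0 + (sumTo m (λ k → f (suc k)) + f (suc (suc m)))        ∎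
  where
  assoc : ∀ x y z → (x + y) + z ≡ x + (y + z)
  assoc = solve-∀

sumTo-+ : ∀ m (f g : ℕ → ℤ) → sumTo m (λ k → f k + g k) ≡ sumTo m f + sumTo m g
sumTo-+ zero    f g = refl
sumTo-+ (suc m) f g = trans (cong (_+ (f (suc m) + g (suc m))) (sumTo-+ m f g))
                            (interchange (sumTo m f) (sumTo m g) (f (suc m)) (g (suc m)))
  where
  interchange : ∀ w x y z → (w + x) + (y + z) ≡ (w + y) + (x + z)
  interchange = solve-∀

sumTo-linear : ∀ m (a : ℤ) (f g : ℕ → ℤ) →
               sumTo m (λ k → a * f k - g k) ≡ a * sumTo m f - sumTo m g
sumTo-linear zero    a f g = refl
sumTo-linear (suc m) a f g =
  trans (cong (_+ (a * f (suc m) - g (suc m))) (sumTo-linear m a f g))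
        (regroup a (sumTo m f) (sumTo m g) (f (suc m)) (g (suc m)))
  where
  regroup : ∀ a s t x y → (a * s - t) + (a * x - y) ≡ a * (s + x) - (t + y)
  regroup = solve-∀

binomialTransform : ℕ → (ℕ → ℤ) → ℤ
binomialTransform m f = sumTo m (λ k → + (m C k) * f k)

shift : (ℕ → ℤ) → ℕ → ℤ
shift f k = f (suc k)

binomialTransform-unfold : ∀ m f →
  binomialTransform m f ≡ f 0 + sumTo m (λ k → + (m C suc k) * f (suc k))
binomialTransform-unfold m f = begin
  binomialTransform m f                                    ≡⟨ sym (last-term-vanishes (k>n⇒nCk≡0 (n<1+n m))) ⟩
  sumTo (suc m) (λ k → + (m C k) * f k)                    ≡⟨ sumTo-unfoldˡ m _ ⟩
  + 1 * f 0 + sumTo m (λ k → + (m C suc k) * f (suc k))   ≡⟨ cong (_+ sumTo m (λ k → + (m C suc k) * f (suc k))) (*-identityˡ (f 0)) ⟩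
  f 0 + sumTo m (λ k → + (m C suc k) * f (suc k))         ∎
  where
  last-term-vanishes : m C suc m ≡ 0 →
                       binomialTransform m f + + (m C suc m) * f (suc m) ≡ binomialTransform m f
  last-term-vanishes c≡0 rewrite c≡0 =
    trans (cong (λ t → binomialTransform m f + t) (*-zeroˡ (f (suc m)))) (+-identityʳ _)

binomialTransform-pascal : ∀ m f →
  binomialTransform (suc m) f ≡ binomialTransform m f + binomialTransform m (shift f)
binomialTransform-pascal m f = begin
  binomialTransform (suc m) f
    ≡⟨ sumTo-unfoldˡ m _ ⟩
  + 1 * f 0 + sumTo m (λ k → + (suc m C suc k) * f (suc k))
    ≡⟨ cong₂ _+_ (*-identityˡ (f 0)) (sumTo-cong m pascal-term) ⟩
  f 0 + sumTo m (λ k → + (m C k) * f (suc k) + + (m C suc k) * f (suc k))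
    ≡⟨ cong (λ t → f 0 + t) (sumTo-+ m _ _) ⟩
  f 0 + (binomialTransform m (shift f) + rest)
    ≡⟨ swap (f 0) (binomialTransform m (shift f)) rest ⟩
  (f 0 + rest) + binomialTransform m (shift f)
    ≡⟨ cong (_+ binomialTransform m (shift f)) (sym (binomialTransform-unfold m f)) ⟩
  binomialTransform m f + binomialTransform m (shift f) ∎
  where
  rest : ℤ
  rest = sumTo m (λ k → + (m C suc k) * f (suc k))
  swap : ∀ x y z → x + (y + z) ≡ (x + z) + y
  swap = solve-∀
  pascal-term : ∀ k → + (suc m C suc k) * f (suc k) ≡ + (m C k) * f (suc k) + + (m C suc k) * f (suc k)
  pascal-term k = begin
    + (suc m C suc k) * f (suc k)                    ≡⟨ cong (λ c → + c * f (suc k)) (sym (nCk+nC[k+1]≡[n+1]C[k+1] m k)) ⟩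
    + (m C k ℕ.+ m C suc k) * f (suc k)              ≡⟨ cong (_* f (suc k)) (sym (pos-+ (m C k) (m C suc k))) ⟩
    (+ (m C k) + + (m C suc k)) * f (suc k)          ≡⟨ *-distribʳ-+ (f (suc k)) (+ (m C k)) (+ (m C suc k)) ⟩
    + (m C k) * f (suc k) + + (m C suc k) * f (suc k) ∎

SatisfiesRecurrence : ℤ → (ℕ → ℤ) → Set
SatisfiesRecurrence a f = ∀ k → f (suc (suc k)) ≡ a * f (suc k) - f k

binomialTransform-+2 : ∀ a f → SatisfiesRecurrence a f → ∀ m →
  binomialTransform (suc (suc m)) f ≡ (+ 2 + a) * binomialTransform m (shift f)
binomialTransform-+2 a f rec m = begin
  T (suc (suc m)) f                            ≡⟨ binomialTransform-pascal (suc m) f ⟩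
  T (suc m) f + T (suc m) f′                   ≡⟨ cong₂ _+_ (binomialTransform-pascal m f) (binomialTransform-pascal m f′) ⟩
  (T m f + T m f′) + (T m f′ + T m (shift f′))  ≡⟨ cong (λ t → (T m f + T m f′) + (T m f′ + t)) transform-rec ⟩
  (T m f + T m f′) + (T m f′ + (a * T m f′ - T m f)) ≡⟨ collect (T m f) (T m f′) a ⟩
  (+ 2 + a) * T m f′                           ∎
  where
  T = binomialTransform
  f′ = shift f
  transform-rec : T m (shift f′) ≡ a * T m f′ - T m f
  transform-rec = begin
    T m (shift f′)                                       ≡⟨ sumTo-cong m (λ k → cong (+ (m C k) *_) (rec k)) ⟩
    sumTo m (λ k → + (m C k) * (a * f′ k - f k))         ≡⟨ sumTo-cong m (λ k → distribute (+ (m C k)) a (f′ k) (f k)) ⟩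
    sumTo m (λ k → a * (+ (m C k) * f′ k) - + (m C k) * f k) ≡⟨ sumTo-linear m a _ _ ⟩
    a * T m f′ - T m f                                   ∎
    where
    distribute : ∀ c a x y → c * (a * x - y) ≡ a * (c * x) - c * y
    distribute = solve-∀
  collect : ∀ x y a → (x + y) + (y + (a * y - x)) ≡ (+ 2 + a) * y
  collect = solve-∀

binomialTransform-double : ∀ a n f → SatisfiesRecurrence a f →
  binomialTransform (2 ℕ.* n) f ≡ (+ 2 + a) ℤ.^ n * f n
binomialTransform-double a zero    f rec = refl
binomialTransform-double a (suc n) f rec = begin
  binomialTransform (2 ℕ.* suc n) f                 ≡⟨ cong (λ m → binomialTransform m f) (*-suc 2 n) ⟩
  binomialTransform (suc (suc (2 ℕ.* n))) f         ≡⟨ binomialTransform-+2 a f rec (2 ℕ.* n) ⟩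
  (+ 2 + a) * binomialTransform (2 ℕ.* n) (shift f) ≡⟨ cong ((+ 2 + a) *_) (binomialTransform-double a n (shift f) (rec ∘suc)) ⟩
  (+ 2 + a) * ((+ 2 + a) ℤ.^ n * f (suc n))         ≡⟨ sym (*-assoc (+ 2 + a) _ _) ⟩
  (+ 2 + a) ℤ.^ suc n * f (suc n)                   ∎
  where
  _∘suc : SatisfiesRecurrence a f → SatisfiesRecurrence a (shift f)
  (r ∘suc) k = r (suc k)

alternating-satisfiesRecurrence : ∀ a f → SatisfiesRecurrence a f →
  SatisfiesRecurrence (- a) (λ k → sgn k * f k)
alternating-satisfiesRecurrence a f rec k = begin
  - - sgn k * f (suc (suc k))           ≡⟨ cong (_* f (suc (suc k))) (neg-involutive (sgn k)) ⟩
  sgn k * f (suc (suc k))               ≡⟨ cong (sgn k *_) (rec k) ⟩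
  sgn k * (a * f (suc k) - f k)         ≡⟨ flip (sgn k) a (f (suc k)) (f k) ⟩
  - a * (- sgn k * f (suc k)) - sgn k * f k ∎
  where
  flip : ∀ s a x y → s * (a * x - y) ≡ - a * (- s * x) - s * y
  flip = solve-∀

pos-^ : ∀ m n → (+ m) ℤ.^ n ≡ + (m ^ n)
pos-^ m zero    = refl
pos-^ m (suc n) = trans (cong (+ m *_) (pos-^ m n)) (sym (pos-* m (m ^ n)))

neg-^-*-sgn : ∀ x n → (- x) ℤ.^ n * sgn n ≡ x ℤ.^ n
neg-^-*-sgn x zero    = refl
neg-^-*-sgn x (suc n) = trans (pull ((- x) ℤ.^ n) (sgn n) x) (cong (x *_) (neg-^-*-sgn x n))
  where
  pull : ∀ p s x → (- x) * p * (- s) ≡ x * (p * s)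
  pull = solve-∀

binomialSum-8ⁿ : ∀ f → SatisfiesRecurrence (+ 6) f → ∀ n →
  sumTo (2 ℕ.* n) (λ k → + ((2 ℕ.* n) C k) * f k) ≡ + (8 ^ n) * f n
binomialSum-8ⁿ f rec n = trans (binomialTransform-double (+ 6) n f rec) (cong (_* f n) (pos-^ 8 n))

alternatingBinomialSum-4ⁿ : ∀ f → SatisfiesRecurrence (+ 6) f → ∀ n →
  sumTo (2 ℕ.* n) (λ k → + ((2 ℕ.* n) C k) * sgn k * f k) ≡ + (4 ^ n) * f n
alternatingBinomialSum-4ⁿ f rec n = begin
  sumTo (2 ℕ.* n) (λ k → + ((2 ℕ.* n) C k) * sgn k * f k)
    ≡⟨ sumTo-cong (2 ℕ.* n) (λ k → *-assoc (+ ((2 ℕ.* n) C k)) (sgn k) (f k)) ⟩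
  binomialTransform (2 ℕ.* n) (λ k → sgn k * f k)
    ≡⟨ binomialTransform-double (- + 6) n _ (alternating-satisfiesRecurrence (+ 6) f rec) ⟩
  (- + 4) ℤ.^ n * (sgn n * f n)
    ≡⟨ sym (*-assoc ((- + 4) ℤ.^ n) (sgn n) (f n)) ⟩
  (- + 4) ℤ.^ n * sgn n * f n
    ≡⟨ cong (_* f n) (trans (neg-^-*-sgn (+ 4) n) (pos-^ 4 n)) ⟩
  + (4 ^ n) * f n ∎

B-satisfiesRecurrence : SatisfiesRecurrence (+ 6) B
B-satisfiesRecurrence k = refl

Cb-satisfiesRecurrence : SatisfiesRecurrence (+ 6) Cb
Cb-satisfiesRecurrence k = refl

proposition4 : (n : ℕ) →
    (sumTo (2 Data.Nat.* n) (λ k → + ((2 Data.Nat.* n) C k) * B k) ≡ + (8 ^ n) * B n)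
    × (sumTo (2 Data.Nat.* n) (λ k → + ((2 Data.Nat.* n) C k) * Cb k) ≡ + (8 ^ n) * Cb n)
    × (sumTo (2 Data.Nat.* n) (λ k → + ((2 Data.Nat.* n) C k) * sgn k * B k) ≡ + (4 ^ n) * B n)
    × (sumTo (2 Data.Nat.* n) (λ k → + ((2 Data.Nat.* n) C k) * sgn k * Cb k) ≡ + (4 ^ n) * Cb n)
proposition4 n =
    binomialSum-8ⁿ B B-satisfiesRecurrence n
  , binomialSum-8ⁿ Cb Cb-satisfiesRecurrence n
  , alternatingBinomialSum-4ⁿ B B-satisfiesRecurrence n
  , alternatingBinomialSum-4ⁿ Cb Cb-satisfiesRecurrence n
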